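{- Let $n$ be an integer with $n>2$. Then the tensor product $K_n\otimes K_n$ is not a circulant graph.
   Context: $K_n$ denotes the complete graph (no loops) on $n$ vertices. The tensor product $G\otimes H$ of graphs $G,H$ has vertex set $V(G)\times V(H)$, with $(g,h)$ adjacent to $(g',h')$ iff $g$ is adjacent to $g'$ in $G$ and $h$ is adjacent to $h'$ in $H$. A graph on $N$ vertices is circulant if its vertices can be labeled by $\mathbb{Z}_N$ so that, for some set $S\subseteq\mathbb{Z}_N$ with $S=-S$, vertices $i$ and $j$ are adjacent iff $j-i\in S \pmod N$ (equivalently, its automorphism group contains a cyclic subgroup acting transitively on the vertices). -}

module Defs where

open import Level using (0ℓ)
open import Data.Nat using (ℕ; _+_; _*_; _∸_; NonZero)
open import Data.Nat.DivMod using (_%_)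
open import Data.Fin using (Fin; toℕ)
open import Data.Product using (Σ; _×_; _,_; proj₁; proj₂)
open import Relation.Binary.PropositionalEquality using (_≡_)
open import Relation.Nullary using (¬_)
open import Function.Bundles using (_⤖_; Bijection)
open import Function using (_⇔_)

record Graph : Set₁ where
  field
    V   : Set
    Adj : V → V → Set

open Graph public

K : ℕ → Graph
K n = record { V = Fin n ; Adj = λ i j → ¬ (i ≡ j) }

_⊗_ : Graph → Graph → Graph
G ⊗ H = record
  { V   = V G × V H
  ; Adj = λ p q → Adj G (proj₁ p) (proj₁ q) × Adj H (proj₂ p) (proj₂ q) }

-- Elements of ℤ_N represented by Fin N; difference j - i mod N as a natural.
diffMod : (N : ℕ) → .{{_ : NonZero N}} → Fin N → Fin N → ℕ
diffMod N j i = (toℕ j + N ∸ toℕ i) % N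

negMod : (N : ℕ) → .{{_ : NonZero N}} → ℕ → ℕ
negMod N r = (N ∸ r) % N

IsCirculant : (G : Graph) (N : ℕ) → .{{_ : NonZero N}} → Set₁
IsCirculant G N =
  Σ (Fin N ⤖ V G) λ lab →
  Σ (ℕ → Set) λ S →
    (∀ r → S r → S (negMod N r)) ×
    (∀ i j → Adj G (Bijection.to lab i) (Bijection.to lab j) ⇔ S (diffMod N j i))

-- Two distinct cells of the n × n grid are non-adjacent in K_n ⊗ K_n exactly when they share a row
-- or a column, so the complement of K_n ⊗ K_n is the rook's graph. A circulant labelling turns the
-- rotation x ↦ x + 1 of ℤ_{n²} into an automorphism g of the rook's graph none of whose powers g^t,
-- 0 < t < n², fixes a cell. Automorphisms of the rook's graph either map rows to rows and columns
-- to columns, or exchange rows and columns. In the first case, by pigeonhole some row returns to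
-- itself after P ≤ n steps and some column after Q ≤ n steps, so g^(QP) fixes the cell where they
-- cross; hence n² ≤ QP, which forces P = Q = n, and then already g^n fixes that cell. In the second
-- case g² keeps rows and columns, the row of some cell x returns after 2d ≤ 2n steps, and then so does the
-- column of g x; the cell on that row and column is fixed by g^(2d), so n² ≤ 2n. Both cases
-- contradict n ≥ 3.

module Submission where

open import Data.Empty using (⊥; ⊥-elim)
open import Data.Fin using (Fin; toℕ; fromℕ<; zero; suc)
open import Data.Fin.Properties using (toℕ-fromℕ<; toℕ<n; toℕ-injective; pigeonhole; nonZeroIndex; _≟_)
open import Data.Nat using (ℕ; zero; suc; _+_; _*_; _∸_; _≤_; _<_; s≤s; NonZero; >-nonZero⁻¹)
open import Data.Nat.DivMod
open import Data.Nat.Divisibility using (_∣_; m%n≡0⇒n∣m; ∣⇒≤)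
open import Data.Nat.Properties hiding (_≟_)
open import Data.Product using (_×_; _,_; proj₁; proj₂; ∃; ∃₂; swap)
open import Data.Product.Properties using (×-≡,≡→≡)
open import Data.Sum using (_⊎_; inj₁; inj₂; [_,_]′)
import Data.Sum as Sum
open import Function using (_∘_; id; Injective; _⇔_; mk⇔; Equivalence)
open import Function.Bundles using (_⤖_; Bijection; Inverse)
open import Function.Properties.Bijection using (⤖⇒↔)
import Function.Properties.Equivalence as ⇔
open import Relation.Binary.PropositionalEquality
open import Relation.Nullary using (¬_)
open import Relation.Nullary.Decidable using (_⊎-dec_; decidable-stable)

open import Defs

module Residues (N : ℕ) .{{_ : NonZero N}} where

  open ≡-Reasoning

  infix 4 _≋_
  _≋_ : ℕ → ℕ → Set
  a ≋ b = a % N ≡ b % N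

  %-≋ : ∀ a → a % N ≋ a
  %-≋ a = m%n%n≡m%n a N

  +-congˡ-≋ : ∀ e {a b} → a ≋ b → e + a ≋ e + b
  +-congˡ-≋ e {a} {b} a≋b = begin
    (e + a) % N          ≡⟨ %-distribˡ-+ e a N ⟩
    (e % N + a % N) % N  ≡⟨ cong (λ r → (e % N + r) % N) a≋b ⟩
    (e % N + b % N) % N  ≡⟨ %-distribˡ-+ e b N ⟨
    (e + b) % N          ∎

  +-congʳ-≋ : ∀ e {a b} → a ≋ b → a + e ≋ b + e
  +-congʳ-≋ e {a} {b} a≋b = begin
    (a + e) % N  ≡⟨ cong (_% N) (+-comm a e) ⟩
    (e + a) % N  ≡⟨ +-congˡ-≋ e a≋b ⟩
    (e + b) % N  ≡⟨ cong (_% N) (+-comm e b) ⟩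
    (b + e) % N  ∎

  +-cancelˡ-≋ : ∀ t {a b} → t + a ≋ t + b → a ≋ b
  +-cancelˡ-≋ t {a} {b} eq = begin
    a % N                ≡⟨ −t+t+ a ⟨
    (−t + (t + a)) % N   ≡⟨ +-congˡ-≋ −t eq ⟩
    (−t + (t + b)) % N   ≡⟨ −t+t+ b ⟩
    b % N                ∎
    where
    −t : ℕ
    −t = N ∸ t % N

    −t+t≡ : −t + t ≡ suc (t / N) * N
    −t+t≡ = begin
      −t + t                       ≡⟨ cong (−t +_) (m≡m%n+[m/n]*n t N) ⟩
      −t + (t % N + t / N * N)     ≡⟨ +-assoc −t (t % N) _ ⟨
      −t + t % N + t / N * N       ≡⟨ cong (_+ t / N * N) (m∸n+n≡m (m%n≤n t N)) ⟩
      N + t / N * N                ∎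

    −t+t+ : ∀ c → −t + (t + c) ≋ c
    −t+t+ c = begin
      (−t + (t + c)) % N          ≡⟨ cong (_% N) (+-assoc −t t c) ⟨
      (−t + t + c) % N            ≡⟨ cong (λ m → (m + c) % N) −t+t≡ ⟩
      (suc (t / N) * N + c) % N   ≡⟨ cong (_% N) (+-comm _ c) ⟩
      (c + suc (t / N) * N) % N   ≡⟨ [m+kn]%n≡m%n c (suc (t / N)) N ⟩
      c % N                       ∎

  toℕ-≋-injective : {x y : Fin N} → toℕ x ≋ toℕ y → x ≡ y
  toℕ-≋-injective {x} {y} eq = toℕ-injective (begin
    toℕ x      ≡⟨ m<n⇒m%n≡m (toℕ<n x) ⟨
    toℕ x % N  ≡⟨ eq ⟩
    toℕ y % N  ≡⟨ m<n⇒m%n≡m (toℕ<n y) ⟩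
    toℕ y      ∎)

  shift : ℕ → Fin N → Fin N
  shift t x = fromℕ< (m%n<n (toℕ x + t) N)

  toℕ-shift : ∀ t x → toℕ (shift t x) ≋ toℕ x + t
  toℕ-shift t x = trans (cong (_% N) (toℕ-fromℕ< _)) (%-≋ (toℕ x + t))

  shift-identity : ∀ x → shift 0 x ≡ x
  shift-identity x = toℕ-≋-injective (trans (toℕ-shift 0 x) (cong (_% N) (+-identityʳ (toℕ x))))

  shift-shift : ∀ s t x → shift s (shift t x) ≡ shift (s + t) x
  shift-shift s t x = toℕ-≋-injective (begin
    toℕ (shift s (shift t x)) % N  ≡⟨ toℕ-shift s (shift t x) ⟩
    (toℕ (shift t x) + s) % N      ≡⟨ +-congʳ-≋ s (toℕ-shift t x) ⟩
    (toℕ x + t + s) % N            ≡⟨ cong (_% N) (+-assoc (toℕ x) t s) ⟩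
    (toℕ x + (t + s)) % N          ≡⟨ cong (λ m → (toℕ x + m) % N) (+-comm t s) ⟩
    (toℕ x + (s + t)) % N          ≡⟨ toℕ-shift (s + t) x ⟨
    toℕ (shift (s + t) x) % N      ∎)

  shift-injective : ∀ t → Injective _≡_ _≡_ (shift t)
  shift-injective t {x} {y} eq = toℕ-≋-injective (+-cancelˡ-≋ t (begin
    (t + toℕ x) % N        ≡⟨ cong (_% N) (+-comm t (toℕ x)) ⟩
    (toℕ x + t) % N        ≡⟨ toℕ-shift t x ⟨
    toℕ (shift t x) % N    ≡⟨ cong (λ z → toℕ z % N) eq ⟩
    toℕ (shift t y) % N    ≡⟨ toℕ-shift t y ⟩
    (toℕ y + t) % N        ≡⟨ cong (_% N) (+-comm (toℕ y) t) ⟩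
    (t + toℕ y) % N        ∎))

  shift-fixed⇒∣ : ∀ t x → shift t x ≡ x → N ∣ t
  shift-fixed⇒∣ t x eq = m%n≡0⇒n∣m t N (begin
    t % N  ≡⟨ +-cancelˡ-≋ (toℕ x) x+t≋x+0 ⟩
    0 % N  ≡⟨ m<n⇒m%n≡m (>-nonZero⁻¹ N) ⟩
    0      ∎)
    where
    x+t≋x+0 : toℕ x + t ≋ toℕ x + 0
    x+t≋x+0 = begin
      (toℕ x + t) % N      ≡⟨ toℕ-shift t x ⟨
      toℕ (shift t x) % N  ≡⟨ cong (λ z → toℕ z % N) eq ⟩
      toℕ x % N            ≡⟨ cong (_% N) (+-identityʳ (toℕ x)) ⟨
      (toℕ x + 0) % N      ∎

  +-diffMod : ∀ x y → toℕ x + diffMod N y x ≋ toℕ y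
  +-diffMod x y = begin
    (toℕ x + (toℕ y + N ∸ toℕ x) % N) % N  ≡⟨ +-congˡ-≋ (toℕ x) (%-≋ (toℕ y + N ∸ toℕ x)) ⟩
    (toℕ x + (toℕ y + N ∸ toℕ x)) % N      ≡⟨ cong (_% N) (m+[n∸m]≡n x≤y+N) ⟩
    (toℕ y + N) % N                        ≡⟨ [m+n]%n≡m%n (toℕ y) N ⟩
    toℕ y % N                              ∎
    where
    x≤y+N : toℕ x ≤ toℕ y + N
    x≤y+N = ≤-trans (<⇒≤ (toℕ<n x)) (m≤n+m N (toℕ y))

  diffMod-shift : ∀ t x y → diffMod N (shift t y) (shift t x) ≡ diffMod N y x
  diffMod-shift t x y = begin
    D′      ≡⟨ %-≋ (toℕ (shift t y) + N ∸ toℕ (shift t x)) ⟨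
    D′ % N  ≡⟨ +-cancelˡ-≋ (toℕ x + t) x+t+D′≋x+t+D ⟩
    D % N   ≡⟨ %-≋ (toℕ y + N ∸ toℕ x) ⟩
    D       ∎
    where
    D D′ : ℕ
    D  = diffMod N y x
    D′ = diffMod N (shift t y) (shift t x)

    x+t+D′≋x+t+D : toℕ x + t + D′ ≋ toℕ x + t + D
    x+t+D′≋x+t+D = begin
      (toℕ x + t + D′) % N             ≡⟨ +-congʳ-≋ D′ (toℕ-shift t x) ⟨
      (toℕ (shift t x) + D′) % N       ≡⟨ +-diffMod (shift t x) (shift t y) ⟩
      toℕ (shift t y) % N              ≡⟨ toℕ-shift t y ⟩
      (toℕ y + t) % N                  ≡⟨ +-congʳ-≋ t (+-diffMod x y) ⟨
      (toℕ x + D + t) % N              ≡⟨ cong (_% N) (+-assoc (toℕ x) D t) ⟩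
      (toℕ x + (D + t)) % N            ≡⟨ cong (λ m → (toℕ x + m) % N) (+-comm D t) ⟩
      (toℕ x + (t + D)) % N            ≡⟨ cong (_% N) (+-assoc (toℕ x) t D) ⟨
      (toℕ x + t + D) % N              ∎

module Powers {x} {X : Set x} where

  open import Function.Endo.Propositional X public using (_^_; ^-homo; ∘-id-monoid)
  open import Algebra.Properties.Monoid.Mult ∘-id-monoid using (×-assocˡ)

  FixedPointFreeBelow : ℕ → (X → X) → Set x
  FixedPointFreeBelow N g = ∀ t p → (g ^ suc t) p ≡ p → N ≤ suc t

  ^-^ : ∀ (g : X → X) m k p → ((g ^ k) ^ m) p ≡ (g ^ (m * k)) p
  ^-^ g m k = cong-app (×-assocˡ g m k)

  ^-commute : ∀ {f h : X → X} → (∀ p → f (h p) ≡ h (f p)) → ∀ m p → f ((h ^ m) p) ≡ (h ^ m) (f p)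
  ^-commute             f∘h≡h∘f zero    p = refl
  ^-commute {f} {h} f∘h≡h∘f (suc m) p = trans (f∘h≡h∘f _) (cong h (^-commute f∘h≡h∘f m p))

  recurrence : ∀ {n} (h : X → X) (F : X → Fin n) (p₀ : X) →
               ∃₂ λ p d → d < n × F p ≡ F ((h ^ suc d) p)
  recurrence {n} h F p₀ with pigeonhole (n<1+n n) (λ i → F ((h ^ toℕ i) p₀))
  ... | i , j , i<j , Fi≡Fj with m≤n⇒∃[o]m+o≡n i<j
  ... | d , 1+i+d≡j = (h ^ toℕ i) p₀ , d , d<n , trans Fi≡Fj (cong F hʲ≡hᵈ⁺¹∘hⁱ)
    where
    j≡1+d+i : toℕ j ≡ suc d + toℕ i
    j≡1+d+i = trans (sym 1+i+d≡j) (cong suc (+-comm (toℕ i) d))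

    hʲ≡hᵈ⁺¹∘hⁱ : (h ^ toℕ j) p₀ ≡ (h ^ suc d) ((h ^ toℕ i) p₀)
    hʲ≡hᵈ⁺¹∘hⁱ = trans (cong (λ m → (h ^ m) p₀) j≡1+d+i) (cong-app (^-homo h (suc d) (toℕ i)) p₀)

    d<n : d < n
    d<n = ≤-trans (s≤s (m≤m+n d (toℕ i))) (≤-trans (≤-reflexive (sym j≡1+d+i)) (≤-pred (toℕ<n j)))

  Preserves : {B C : Set x} → (X → B) → (X → C) → (X → X) → Set x
  Preserves F G h = ∀ {p q} → F p ≡ F q → G (h p) ≡ G (h q)

  return-^ : ∀ {B : Set x} {F : X → B} {h} → Preserves F F h →
            ∀ {p} → F p ≡ F (h p) → ∀ m → F p ≡ F ((h ^ m) p)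
  return-^ preserves e zero = refl
  return-^ {F = F} {h} preserves {p} e (suc m) =
    trans e (preserves {p} {(h ^ m) p} (return-^ {F = F} {h} preserves e m))

open Powers

module Grid {a} {A : Set a} where

  Collinear : A × A → A × A → Set a
  Collinear p q = proj₁ p ≡ proj₁ q ⊎ proj₂ p ≡ proj₂ q

  KeepsLines SwapsLines : (A × A → A × A) → Set a
  KeepsLines h = Preserves proj₁ proj₁ h × Preserves proj₂ proj₂ h
  SwapsLines h = Preserves proj₁ proj₂ h × Preserves proj₂ proj₁ h

  keepsLines-∘ : ∀ {h k} → KeepsLines h → KeepsLines k → KeepsLines (k ∘ h)
  keepsLines-∘ (h₁ , h₂) (k₁ , k₂) = k₁ ∘ h₁ , k₂ ∘ h₂

  swapsLines-∘ : ∀ {h k} → SwapsLines h → SwapsLines k → KeepsLines (k ∘ h)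
  swapsLines-∘ (h₁₂ , h₂₁) (k₁₂ , k₂₁) = k₂₁ ∘ h₁₂ , k₁₂ ∘ h₂₁

  keepsLines-^ : ∀ {h} → KeepsLines h → ∀ m → KeepsLines (h ^ m)
  keepsLines-^ keeps zero    = id , id
  keepsLines-^ keeps (suc m) = keepsLines-∘ (keepsLines-^ keeps m) keeps

  keepsLines-fixes : ∀ {k} → KeepsLines k → ∀ {p q} →
                     proj₁ p ≡ proj₁ (k p) → proj₂ q ≡ proj₂ (k q) →
                     k (proj₁ p , proj₂ q) ≡ (proj₁ p , proj₂ q)
  keepsLines-fixes (k₁ , k₂) {p} {q} e₁ e₂ =
    ×-≡,≡→≡ (trans (k₁ {_ , proj₂ q} {p} refl) (sym e₁) , trans (k₂ {proj₁ p , _} {q} refl) (sym e₂))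

  collinear-with-row⇒on-row : ∀ {p q s} → p ≢ q → proj₁ p ≡ proj₁ q →
                              Collinear p s → Collinear q s → proj₁ p ≡ proj₁ s
  collinear-with-row⇒on-row p≢q pq (inj₁ ps) _          = ps
  collinear-with-row⇒on-row p≢q pq (inj₂ ps) (inj₁ qs) = trans pq qs
  collinear-with-row⇒on-row p≢q pq (inj₂ ps) (inj₂ qs) = ⊥-elim (p≢q (×-≡,≡→≡ (pq , trans ps (sym qs))))

  collinear-with-column⇒on-column : ∀ {p q s} → p ≢ q → proj₂ p ≡ proj₂ q →
                                    Collinear p s → Collinear q s → proj₂ p ≡ proj₂ s
  collinear-with-column⇒on-column p≢q pq (inj₂ ps) _          = ps
  collinear-with-column⇒on-column p≢q pq (inj₁ ps) (inj₂ qs) = trans pq qs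
  collinear-with-column⇒on-column p≢q pq (inj₁ ps) (inj₁ qs) = ⊥-elim (p≢q (×-≡,≡→≡ (trans ps (sym qs) , pq)))

  collinear-family⇒line : ∀ {ℓ} {I : Set ℓ} (h : I → A × A) {i₀ i₁ : I} → h i₀ ≢ h i₁ →
                          (∀ i j → Collinear (h i) (h j)) →
                          (∀ j → proj₁ (h i₀) ≡ proj₁ (h j)) ⊎ (∀ j → proj₂ (h i₀) ≡ proj₂ (h j))
  collinear-family⇒line h {i₀} {i₁} h₀≢h₁ col with col i₀ i₁
  ... | inj₁ same-row    = inj₁ λ j → collinear-with-row⇒on-row h₀≢h₁ same-row (col i₀ j) (col i₁ j)
  ... | inj₂ same-column = inj₂ λ j → collinear-with-column⇒on-column h₀≢h₁ same-column (col i₀ j) (col i₁ j)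

  module _ {a₀ a₁ : A} (a₀≢a₁ : a₀ ≢ a₁) {g : A × A → A × A} (g-injective : Injective _≡_ _≡_ g)
           (g-collinear : ∀ {p q} → Collinear p q → Collinear (g p) (g q)) where

    HorizontalRow VerticalRow : A → Set a
    HorizontalRow i = ∀ j → proj₁ (g (i , a₀)) ≡ proj₁ (g (i , j))
    VerticalRow   i = ∀ j → proj₂ (g (i , a₀)) ≡ proj₂ (g (i , j))

    row-horizontal⊎vertical : ∀ i → HorizontalRow i ⊎ VerticalRow i
    row-horizontal⊎vertical i =
      collinear-family⇒line (λ j → g (i , j)) (a₀≢a₁ ∘ cong proj₂ ∘ g-injective) (λ _ _ → g-collinear (inj₁ refl))

    -- For every j the images of (i , j) and (i′ , j) are collinear, which forces one of them onto
    -- the corner cell; since g is injective, two different j cannot both land there.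
    ¬horizontal×vertical : ∀ {i i′} → HorizontalRow i → VerticalRow i′ → ⊥
    ¬horizontal×vertical {i} {i′} H V =
      a₀≢a₁ (cong proj₂ (g-injective (trans (proj₂ (hit a₀)) (sym (proj₂ (hit a₁))))))
      where
      corner : A × A
      corner = proj₁ (g (i , a₀)) , proj₂ (g (i′ , a₀))

      hit : ∀ j → ∃ λ b → g (b , j) ≡ corner
      hit j with g-collinear {i , j} {i′ , j} (inj₂ refl)
      ... | inj₁ same-row    = i′ , ×-≡,≡→≡ (trans (sym same-row) (sym (H j)) , sym (V j))
      ... | inj₂ same-column = i  , ×-≡,≡→≡ (sym (H j) , trans same-column (sym (V j)))

    rows-uniform : Preserves proj₁ proj₁ g ⊎ Preserves proj₁ proj₂ g
    rows-uniform with row-horizontal⊎vertical a₀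
    ... | inj₁ H₀ = inj₁ λ { {i , j} {.i , j′} refl → trans (sym (horizontal i j)) (horizontal i j′) }
      where
      horizontal : ∀ i → HorizontalRow i
      horizontal i = [ id , ⊥-elim ∘ ¬horizontal×vertical H₀ ]′ (row-horizontal⊎vertical i)
    ... | inj₂ V₀ = inj₂ λ { {i , j} {.i , j′} refl → trans (sym (vertical i j)) (vertical i j′) }
      where
      vertical : ∀ i → VerticalRow i
      vertical i = [ ⊥-elim ∘ (λ H → ¬horizontal×vertical H V₀) , id ]′ (row-horizontal⊎vertical i)

  transpose-preserves : ∀ {G : A × A → A} {h} → Preserves proj₁ G (h ∘ swap) → Preserves proj₂ G h
  transpose-preserves P {p} {q} = P {swap p} {swap q}

  rook-automorphism : ∀ {a₀ a₁ : A} → a₀ ≢ a₁ → ∀ {g : A × A → A × A} → Injective _≡_ _≡_ g →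
                      (∀ {p q} → Collinear p q → Collinear (g p) (g q)) →
                      (∀ {p q} → Collinear (g p) (g q) → Collinear p q) →
                      KeepsLines g ⊎ SwapsLines g
  rook-automorphism {a₀} {a₁} a₀≢a₁ {g} g-injective g-collinear g-collinear⁻¹ = combine rows columns
    where
    rows : Preserves proj₁ proj₁ g ⊎ Preserves proj₁ proj₂ g
    rows = rows-uniform a₀≢a₁ g-injective g-collinear

    columns : Preserves proj₂ proj₁ g ⊎ Preserves proj₂ proj₂ g
    columns = Sum.map (transpose-preserves {proj₁} {g}) (transpose-preserves {proj₂} {g})
                      (rows-uniform a₀≢a₁ (cong swap ∘ g-injective) (g-collinear ∘ Sum.swap))

    ¬antidiagonal : ¬ Collinear (g (a₀ , a₁)) (g (a₁ , a₀))
    ¬antidiagonal = [ a₀≢a₁ , a₀≢a₁ ∘ sym ]′ ∘ g-collinear⁻¹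

    combine : Preserves proj₁ proj₁ g ⊎ Preserves proj₁ proj₂ g →
              Preserves proj₂ proj₁ g ⊎ Preserves proj₂ proj₂ g → KeepsLines g ⊎ SwapsLines g
    combine (inj₁ rows₁₁) (inj₂ columns₂₂) = inj₁ (rows₁₁ , columns₂₂)
    combine (inj₂ rows₁₂) (inj₁ columns₂₁) = inj₂ (rows₁₂ , columns₂₁)
    combine (inj₁ rows₁₁) (inj₁ columns₂₁) = ⊥-elim (¬antidiagonal (inj₁
      (trans (rows₁₁ {a₀ , a₁} {a₀ , a₀} refl) (columns₂₁ {a₀ , a₀} {a₁ , a₀} refl))))
    combine (inj₂ rows₁₂) (inj₂ columns₂₂) = ⊥-elim (¬antidiagonal (inj₂
      (trans (rows₁₂ {a₀ , a₁} {a₀ , a₀} refl) (columns₂₂ {a₀ , a₀} {a₁ , a₀} refl))))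

module _ {n : ℕ} {g : Fin n × Fin n → Fin n × Fin n} (g-free : FixedPointFreeBelow (n * n) g)
         (p₀ : Fin n × Fin n) where

  open Grid

  private instance
    n≢0 : NonZero n
    n≢0 = nonZeroIndex (proj₁ p₀)

  keepsLines⇒n≤1 : KeepsLines g → n ≤ 1
  keepsLines⇒n≤1 keeps with recurrence g proj₁ p₀ | recurrence g proj₂ p₀
  ... | x , d , d<n , x-row-returns | y , e , e<n , y-column-returns =
    *-cancelˡ-≤ n (≤-trans n*n≤P (≤-trans d<n (≤-reflexive (sym (*-identityʳ n)))))
    where
    P Q : ℕ
    P = suc d
    Q = suc e

    row-returns-QP : proj₁ x ≡ proj₁ ((g ^ (Q * P)) x)
    row-returns-QP = trans (return-^ {F = proj₁} {g ^ P} (proj₁ (keepsLines-^ keeps P)) {x} x-row-returns Q)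
                           (cong proj₁ (^-^ g Q P x))

    column-returns-QP : proj₂ y ≡ proj₂ ((g ^ (Q * P)) y)
    column-returns-QP = trans (return-^ {F = proj₂} {g ^ Q} (proj₂ (keepsLines-^ keeps Q)) {y} y-column-returns P)
                              (cong proj₂ (trans (^-^ g P Q y) (cong (λ m → (g ^ m) y) (*-comm P Q))))

    n*n≤Q*P : n * n ≤ Q * P
    n*n≤Q*P = g-free _ _ (keepsLines-fixes (keepsLines-^ keeps (Q * P)) row-returns-QP column-returns-QP)

    Q≡P : Q ≡ P
    Q≡P = trans (≤-antisym e<n n≤Q) (≤-antisym n≤P d<n)
      where
      n≤P : n ≤ P
      n≤P = *-cancelˡ-≤ n (≤-trans n*n≤Q*P (*-monoˡ-≤ P e<n))
      n≤Q : n ≤ Q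
      n≤Q = *-cancelˡ-≤ n (≤-trans n*n≤Q*P (≤-trans (*-monoʳ-≤ Q d<n) (≤-reflexive (*-comm Q n))))

    n*n≤P : n * n ≤ P
    n*n≤P = g-free _ _ (keepsLines-fixes (keepsLines-^ keeps P) x-row-returns
                         (subst (λ m → proj₂ y ≡ proj₂ ((g ^ m) y)) Q≡P y-column-returns))

  swapsLines⇒n≤2 : SwapsLines g → n ≤ 2
  swapsLines⇒n≤2 swaps with recurrence (g ^ 2) proj₁ p₀
  ... | x , d , d<n , x-row-returns = *-cancelˡ-≤ n (≤-trans n*n≤[1+d]*2 (*-monoˡ-≤ 2 d<n))
    where
    k : Fin n × Fin n → Fin n × Fin n
    k = (g ^ 2) ^ suc d

    gx-column-returns : proj₂ (g x) ≡ proj₂ (k (g x))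
    gx-column-returns = trans (proj₁ swaps {x} {k x} x-row-returns)
                              (cong proj₂ (^-commute {f = g} {g ^ 2} (λ _ → refl) (suc d) x))

    n*n≤[1+d]*2 : n * n ≤ suc d * 2
    n*n≤[1+d]*2 = g-free _ _ (trans (sym (^-^ g (suc d) 2 _))
                               (keepsLines-fixes (keepsLines-^ {h = g ^ 2} (swapsLines-∘ swaps swaps) (suc d))
                                                 x-row-returns gx-column-returns))

module _ {n : ℕ} where

  open Grid {A = Fin n}

  Adjacent : Fin n × Fin n → Fin n × Fin n → Set
  Adjacent = Adj (K n ⊗ K n)

  collinear⇔¬adjacent : ∀ {p q} → Collinear p q ⇔ (¬ Adjacent p q)
  collinear⇔¬adjacent {p} {q} = mk⇔
    (λ col (rows≢ , columns≢) → [ rows≢ , columns≢ ]′ col)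
    (λ ¬adj → decidable-stable (proj₁ p ≟ proj₁ q ⊎-dec proj₂ p ≟ proj₂ q)
                               (λ ¬col → ¬adj (¬col ∘ inj₁ , ¬col ∘ inj₂)))

  collinear-transfer : ∀ {p q p′ q′} → Adjacent p q ⇔ Adjacent p′ q′ → Collinear p q → Collinear p′ q′
  collinear-transfer adj = Equivalence.from collinear⇔¬adjacent
                         ∘ (λ ¬adj → ¬adj ∘ Equivalence.from adj)
                         ∘ Equivalence.to collinear⇔¬adjacent

module CirculantLabelling {n : ℕ} .{{_ : NonZero (n * n)}}
  (lab : Fin (n * n) ⤖ (Fin n × Fin n)) (S : ℕ → Set)
  (adjacent⇔ : ∀ i j → Adjacent (Bijection.to lab i) (Bijection.to lab j) ⇔ S (diffMod (n * n) j i)) where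

  open Residues (n * n)
  open Inverse (⤖⇒↔ lab) using (to; from; strictlyInverseˡ; strictlyInverseʳ)
  open Grid {A = Fin n}
  open ≡-Reasoning

  rotation : Fin n × Fin n → Fin n × Fin n
  rotation p = to (shift 1 (from p))

  rotation-injective : Injective _≡_ _≡_ rotation
  rotation-injective {p} {q} eq = begin
    p              ≡⟨ strictlyInverseˡ p ⟨
    to (from p)    ≡⟨ cong to (shift-injective 1 shifts-equal) ⟩
    to (from q)    ≡⟨ strictlyInverseˡ q ⟩
    q              ∎
    where
    shifts-equal : shift 1 (from p) ≡ shift 1 (from q)
    shifts-equal = begin
      shift 1 (from p)              ≡⟨ strictlyInverseʳ _ ⟨
      from (rotation p)             ≡⟨ cong from eq ⟩
      from (rotation q)             ≡⟨ strictlyInverseʳ _ ⟩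
      shift 1 (from q)              ∎

  rotation-adjacent : ∀ p q → Adjacent p q ⇔ Adjacent (rotation p) (rotation q)
  rotation-adjacent p q = ⇔.trans adjacent⇔S
    (subst (λ d → S d ⇔ Adjacent (rotation p) (rotation q)) (diffMod-shift 1 (from p) (from q))
           (⇔.sym (adjacent⇔ (shift 1 (from p)) (shift 1 (from q)))))
    where
    adjacent⇔S : Adjacent p q ⇔ S (diffMod (n * n) (from q) (from p))
    adjacent⇔S = subst₂ (λ p′ q′ → Adjacent p′ q′ ⇔ S (diffMod (n * n) (from q) (from p)))
                        (strictlyInverseˡ p) (strictlyInverseˡ q) (adjacent⇔ (from p) (from q))

  rotation-collinear : ∀ {p q} → Collinear p q → Collinear (rotation p) (rotation q)
  rotation-collinear {p} {q} = collinear-transfer (rotation-adjacent p q)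

  rotation-collinear⁻¹ : ∀ {p q} → Collinear (rotation p) (rotation q) → Collinear p q
  rotation-collinear⁻¹ {p} {q} = collinear-transfer (⇔.sym (rotation-adjacent p q))

  rotation-^ : ∀ t p → (rotation ^ t) p ≡ to (shift t (from p))
  rotation-^ zero    p = sym (trans (cong to (shift-identity (from p))) (strictlyInverseˡ p))
  rotation-^ (suc t) p = begin
    rotation ((rotation ^ t) p)           ≡⟨ cong rotation (rotation-^ t p) ⟩
    to (shift 1 (from (to (shift t x))))  ≡⟨ cong (to ∘ shift 1) (strictlyInverseʳ (shift t x)) ⟩
    to (shift 1 (shift t x))              ≡⟨ cong to (shift-shift 1 t x) ⟩
    to (shift (suc t) x)                  ∎
    where
    x : Fin (n * n)
    x = from p

  rotation-fixedPointFree : FixedPointFreeBelow (n * n) rotation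
  rotation-fixedPointFree t p fixed = ∣⇒≤ (shift-fixed⇒∣ (suc t) (from p) (begin
    shift (suc t) (from p)               ≡⟨ strictlyInverseʳ _ ⟨
    from (to (shift (suc t) (from p)))   ≡⟨ cong from (trans (sym (rotation-^ (suc t) p)) fixed) ⟩
    from p                               ∎))

theorem4 : (n : ℕ) → 2 < n → .{{_ : NonZero (n * n)}} → ¬ IsCirculant (K n ⊗ K n) (n * n)
theorem4 1 (s≤s ())
theorem4 2 (s≤s (s≤s ()))
theorem4 n@(suc (suc (suc _))) 2<n (lab , S , _ , adjacent⇔) = <⇒≱ 2<n n≤2
  where
  open CirculantLabelling lab S adjacent⇔
  open Grid

  p₀ : Fin n × Fin n
  p₀ = zero , zero

  n≤2 : n ≤ 2
  n≤2 = [ (λ keeps → m≤n⇒m≤1+n (keepsLines⇒n≤1 rotation-fixedPointFree p₀ keeps))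
        , swapsLines⇒n≤2 rotation-fixedPointFree p₀
        ]′ (rook-automorphism {a₀ = zero} {suc zero} (λ ()) rotation-injective rotation-collinear rotation-collinear⁻¹)
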